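{- Let $X=\{1,-1\}$ and let $\phi:X^*\to X^*$ be the monoid endomorphism defined by $\phi(1)=1\,1\,(-1)$ and $\phi(-1)=1\,(-1)\,(-1)$. Since $\phi^n(1)$ is a proper prefix of $\phi^{n+1}(1)$ for all $n\ge 0$, the limit $w_\alpha=\lim_{n\to\infty}\phi^n(1)$ is a well-defined infinite sequence over $X$. Then $w_\alpha$ is cube-free, i.e. it contains no factor (contiguous subword) of the form $uuu$ with $u$ a nonempty finite word over $X$. -}

module Defs where

open import Data.Nat using (ℕ; zero; suc; _+_; _<_)
open import Data.List using (List; []; _∷_; _++_; concatMap; length)
open import Data.Fin using (Fin; toℕ)
open import Relation.Binary.PropositionalEquality using (_≡_)
open import Data.Empty using (⊥)

-- The alphabet X = {1, -1}: pos stands for 1, neg stands for -1.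
data X : Set where
  pos neg : X

φ₁ : X → List X
φ₁ pos = pos ∷ pos ∷ neg ∷ []
φ₁ neg = pos ∷ neg ∷ neg ∷ []

φ : List X → List X
φ = concatMap φ₁

φ^ : ℕ → List X → List X
φ^ zero    w = w
φ^ (suc n) w = φ (φ^ n w)

-- total list indexing with a default value (used only within range below)
at : List X → ℕ → X
at []       _       = pos
at (x ∷ xs) zero    = x
at (x ∷ xs) (suc i) = at xs i

-- The limit word w_α = lim φ^n(1): its i-th letter (0-based) is the i-th
-- letter of φ^(i+1)(1), which has length 3^(i+1) > i, and all later
-- iterates agree with it there since φ^n(1) is a prefix of φ^(n+1)(1).
wα : ℕ → X
wα i = at (φ^ (suc i) (pos ∷ [])) i

OccursAt : (ℕ → X) → ℕ → List X → Set
OccursAt w i v = (k : Fin (length v)) → w (i + toℕ k) ≡ Data.List.lookup v k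

CubeFree : (ℕ → X) → Set
CubeFree w = (u : List X) → 0 < length u → (i : ℕ) → OccursAt w i (u ++ u ++ u) → ⊥

-- Since φ maps each letter x to 1 x (-1), the word w = wα is the fixed
-- point of φ read letterwise: w(3k) = 1, w(3k+1) = w(k), w(3k+2) = -1.
-- A cube of period p at position i gives w(x) = w(x + p) for all x in a
-- window of length 2p starting at i. If p ≢ 0 (mod 3), some x among the first
-- three positions of the window has x ≡ 0 and x + p ≡ 2 (mod 3), or x ≡ 2 and
-- x + p ≡ 0, forcing 1 = -1 (for p = 1 the letters at i, i+1, i+2 coincide,
-- with the same effect). If p = 3q, the positions ≡ 1 (mod 3) of the window
-- carry a cube of period q, and we conclude by induction on p.
module Submission where

open import Defs
open import Data.Nat using (ℕ; zero; suc; _+_; _*_; _<_; _≤_; _≤′_; ≤′-refl; ≤′-step; z≤n; s≤s; >-nonZero)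
open import Data.Nat.Properties
open import Data.Nat.Induction using (<-rec)
open import Data.Nat.Tactic.RingSolver using (solve-∀)
open import Data.List using (List; []; _∷_; [_]; _++_; length; lookup)
open import Data.List.Properties using (length-++; ++-assoc; ++-identityʳ; concatMap-++)
open import Data.Fin using (fromℕ<)
open import Data.Fin.Properties using (toℕ-fromℕ<)
open import Data.Product using (∃; ∃₂; _×_; _,_)
open import Data.Sum using (inj₁; inj₂)
open import Relation.Nullary using (¬_)
open import Relation.Binary.PropositionalEquality using (_≡_; _≢_; refl; sym; trans; cong; subst; module ≡-Reasoning)

pos≢neg : pos ≢ neg
pos≢neg ()

at-++ˡ : ∀ u v {j} → j < length u → at (u ++ v) j ≡ at u j
at-++ˡ (x ∷ u) v {zero}  _         = refl
at-++ˡ (x ∷ u) v {suc j} (s≤s j<n) = at-++ˡ u v j<n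

at-++ʳ : ∀ u v j → at (u ++ v) (length u + j) ≡ at v j
at-++ʳ []      v j = refl
at-++ʳ (x ∷ u) v j = at-++ʳ u v j

lookup-fromℕ< : ∀ v {j} (j<n : j < length v) → lookup v (fromℕ< j<n) ≡ at v j
lookup-fromℕ< (x ∷ v) {zero}  _         = refl
lookup-fromℕ< (x ∷ v) {suc j} (s≤s j<n) = lookup-fromℕ< v j<n

k*3+r<n*3 : ∀ {k n r} → k < n → r < 3 → k * 3 + r < n * 3
k*3+r<n*3 {k} {n} {r} k<n r<3 = begin-strict
  k * 3 + r  <⟨ +-monoʳ-< (k * 3) r<3 ⟩
  k * 3 + 3  ≡⟨ +-comm (k * 3) 3 ⟩
  suc k * 3  ≤⟨ *-monoˡ-≤ 3 k<n ⟩
  n * 3      ∎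
  where open ≤-Reasoning

<3⇒<p+p : ∀ {o} p → 2 ≤ p → o < 3 → o < p + p
<3⇒<p+p _ 2≤p o<3 = <-≤-trans o<3 (≤-trans (n≤1+n 3) (+-mono-≤ 2≤p 2≤p))

data Mod3 : ℕ → Set where
  3k+0 : ∀ k → Mod3 (k * 3 + 0)
  3k+1 : ∀ k → Mod3 (k * 3 + 1)
  3k+2 : ∀ k → Mod3 (k * 3 + 2)

mod3 : ∀ n → Mod3 n
mod3 zero = 3k+0 zero
mod3 (suc n) with mod3 n
... | 3k+0 k = subst Mod3 (+-suc (k * 3) 0) (3k+1 k)
... | 3k+1 k = subst Mod3 (+-suc (k * 3) 1) (3k+2 k)
... | 3k+2 k = subst Mod3 (cong suc (sym (trans (+-suc (k * 3) 1) (cong suc (+-suc (k * 3) 0))))) (3k+0 (suc k))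

shift-to-residue : ∀ i {r} → r < 3 → ∃₂ λ o k → o < 3 × i + o ≡ k * 3 + r
shift-to-residue zero    {r} r<3 = r , 0 , r<3 , refl
shift-to-residue (suc i) {r} r<3 with shift-to-residue i r<3
... | suc o , k , s≤s o<2 , i+1+o≡ = o , k , m<n⇒m<1+n o<2 , trans (sym (+-suc i o)) i+1+o≡
... | zero  , k , _       , i+0≡    = 2 , suc k , s≤s (s≤s (s≤s z≤n)) , cong suc (begin
  i + 2                 ≡⟨ +-comm i 2 ⟩
  suc (suc i)           ≡⟨ cong (λ m → suc (suc m)) (trans (sym (+-identityʳ i)) i+0≡) ⟩
  suc (suc (k * 3 + r)) ∎)
  where open ≡-Reasoning

IsFixedPoint : (ℕ → X) → Set
IsFixedPoint w = ∀ k r → r < 3 → w (k * 3 + r) ≡ at (φ₁ (w k)) r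

length-φ : ∀ v → length (φ v) ≡ length v * 3
length-φ []      = refl
length-φ (pos ∷ v) = cong (3 +_) (length-φ v)
length-φ (neg ∷ v) = cong (3 +_) (length-φ v)

at-φ : ∀ v {k r} → k < length v → r < 3 → at (φ v) (k * 3 + r) ≡ at (φ₁ (at v k)) r
at-φ (pos ∷ v) {zero}  _         r<3 = at-++ˡ (φ₁ pos) (φ v) r<3
at-φ (neg ∷ v) {zero}  _         r<3 = at-++ˡ (φ₁ neg) (φ v) r<3
at-φ (pos ∷ v) {suc k} (s≤s k<n) r<3 = at-φ v k<n r<3
at-φ (neg ∷ v) {suc k} (s≤s k<n) r<3 = at-φ v k<n r<3

φ^-extends : ∀ n → ∃ λ s → φ^ (suc n) [ pos ] ≡ φ^ n [ pos ] ++ s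
φ^-extends zero    = pos ∷ neg ∷ [] , refl
φ^-extends (suc n) with φ^-extends n
... | s , eq = φ s , trans (cong φ eq) (concatMap-++ φ₁ (φ^ n [ pos ]) s)

φ^-prefix : ∀ {m n} → m ≤′ n → ∃ λ s → φ^ n [ pos ] ≡ φ^ m [ pos ] ++ s
φ^-prefix {m} ≤′-refl = [] , sym (++-identityʳ (φ^ m [ pos ]))
φ^-prefix {m} (≤′-step {n} m≤n) with φ^-prefix m≤n | φ^-extends n
... | s , eq | t , eq′ = s ++ t , (begin
  φ^ (suc n) [ pos ]         ≡⟨ eq′ ⟩
  φ^ n [ pos ] ++ t          ≡⟨ cong (_++ t) eq ⟩
  (φ^ m [ pos ] ++ s) ++ t   ≡⟨ ++-assoc (φ^ m [ pos ]) s t ⟩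
  φ^ m [ pos ] ++ (s ++ t)   ∎)
  where open ≡-Reasoning

at-φ^-stable : ∀ {m n i} → m ≤ n → i < length (φ^ m [ pos ]) → at (φ^ n [ pos ]) i ≡ at (φ^ m [ pos ]) i
at-φ^-stable {m} {i = i} m≤n i<len with φ^-prefix (≤⇒≤′ m≤n)
... | s , eq = trans (cong (λ v → at v i) eq) (at-++ˡ (φ^ m [ pos ]) s i<len)

length-φ-grows : ∀ {n} v → n < length v → suc n < length (φ v)
length-φ-grows {n} v n<len = begin-strict
  suc n         ≤⟨ n<len ⟩
  length v      <⟨ m<m*n (length v) 3 {{>-nonZero (≤-<-trans z≤n n<len)}} (s≤s (s≤s z≤n)) ⟩
  length v * 3  ≡⟨ length-φ v ⟨
  length (φ v)  ∎
  where open ≤-Reasoning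

n<length-φ^suc : ∀ n → n < length (φ^ (suc n) [ pos ])
n<length-φ^suc zero    = s≤s z≤n
n<length-φ^suc (suc n) = length-φ-grows (φ^ (suc n) [ pos ]) (n<length-φ^suc n)

wα-at : ∀ n {i} → i < length (φ^ n [ pos ]) → wα i ≡ at (φ^ n [ pos ]) i
wα-at n {i} i<len with ≤-total (suc i) n
... | inj₁ 1+i≤n = sym (at-φ^-stable 1+i≤n (n<length-φ^suc i))
... | inj₂ n≤1+i = at-φ^-stable n≤1+i i<len

wα-isFixedPoint : IsFixedPoint wα
wα-isFixedPoint k r r<3 = begin
  wα (k * 3 + r)                              ≡⟨ wα-at (suc (suc k)) index<length ⟩
  at (φ (φ^ (suc k) [ pos ])) (k * 3 + r)     ≡⟨ at-φ (φ^ (suc k) [ pos ]) (n<length-φ^suc k) r<3 ⟩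
  at (φ₁ (wα k)) r                            ∎
  where
  open ≡-Reasoning
  index<length : k * 3 + r < length (φ (φ^ (suc k) [ pos ]))
  index<length = subst (k * 3 + r <_) (sym (length-φ (φ^ (suc k) [ pos ])))
                       (k*3+r<n*3 (n<length-φ^suc k) r<3)

record CubeAt {A : Set} (w : ℕ → A) (p i : ℕ) : Set where
  constructor cubeAt
  field
    repeats : ∀ j → j < p + p → w (i + j) ≡ w (i + j + p)

repeats-at : ∀ {A : Set} {w : ℕ → A} {p i j x} → CubeAt w p i → j < p + p → i + j ≡ x → w x ≡ w (x + p)
repeats-at (cubeAt repeats) j<2p refl = repeats _ j<2p

occursAt-at : ∀ {w i} v {j} → OccursAt w i v → j < length v → w (i + j) ≡ at v j
occursAt-at {w} {i} v {j} occ j<n = begin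
  w (i + j)                    ≡⟨ cong (λ m → w (i + m)) (toℕ-fromℕ< j<n) ⟨
  w (i + _)                    ≡⟨ occ (fromℕ< j<n) ⟩
  lookup v (fromℕ< j<n)        ≡⟨ lookup-fromℕ< v j<n ⟩
  at v j                       ∎
  where open ≡-Reasoning

at-cube-shift : ∀ u {j} → j < length u + length u → at (u ++ u ++ u) (length u + j) ≡ at (u ++ u ++ u) j
at-cube-shift u {j} j<2p = begin
  at (u ++ u ++ u) (length u + j)  ≡⟨ at-++ʳ u (u ++ u) j ⟩
  at (u ++ u) j                    ≡⟨ at-++ˡ (u ++ u) u (subst (j <_) (sym (length-++ u)) j<2p) ⟨
  at ((u ++ u) ++ u) j             ≡⟨ cong (λ v → at v j) (++-assoc u u u) ⟩
  at (u ++ u ++ u) j               ∎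
  where open ≡-Reasoning

occurs-cube⇒cubeAt : ∀ {w i} u → OccursAt w i (u ++ u ++ u) → CubeAt w (length u) i
occurs-cube⇒cubeAt {w} {i} u occ = cubeAt λ j j<2p → begin
  w (i + j)                        ≡⟨ occursAt-at {w} {i} (u ++ u ++ u) occ (j<|uuu| j<2p) ⟩
  at (u ++ u ++ u) j               ≡⟨ at-cube-shift u j<2p ⟨
  at (u ++ u ++ u) (p + j)         ≡⟨ occursAt-at {w} {i} (u ++ u ++ u) occ (p+j<|uuu| j<2p) ⟨
  w (i + (p + j))                  ≡⟨ cong w (trans (cong (i +_) (+-comm p j)) (sym (+-assoc i j p))) ⟩
  w (i + j + p)                    ∎
  where
  open ≡-Reasoning
  p : ℕ
  p = length u
  length-uuu : p + (p + p) ≡ length (u ++ u ++ u)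
  length-uuu = sym (trans (length-++ u) (cong (p +_) (length-++ u)))
  j<|uuu| : ∀ {j} → j < p + p → j < length (u ++ u ++ u)
  j<|uuu| {j} j<2p = subst (j <_) length-uuu (<-≤-trans j<2p (m≤n+m (p + p) p))
  p+j<|uuu| : ∀ {j} → j < p + p → p + j < length (u ++ u ++ u)
  p+j<|uuu| {j} j<2p = subst (p + j <_) length-uuu (+-monoʳ-< p j<2p)

module FixedPoint (w : ℕ → X) (w-fixed : IsFixedPoint w) where

  open ≡-Reasoning

  w-3k+0 : ∀ k → w (k * 3 + 0) ≡ pos
  w-3k+0 k with w k | w-fixed k 0 (s≤s z≤n)
  ... | pos | eq = eq
  ... | neg | eq = eq

  w-3k+1 : ∀ k → w (k * 3 + 1) ≡ w k
  w-3k+1 k with w k | w-fixed k 1 (s≤s (s≤s z≤n))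
  ... | pos | eq = eq
  ... | neg | eq = eq

  w-3k+2 : ∀ k → w (k * 3 + 2) ≡ neg
  w-3k+2 k with w k | w-fixed k 2 (s≤s (s≤s (s≤s z≤n)))
  ... | pos | eq = eq
  ... | neg | eq = eq

  ¬cube-1 : ∀ {i} → ¬ CubeAt w 1 i
  ¬cube-1 {i} cube with shift-to-residue i {0} (s≤s z≤n) | shift-to-residue i {2} (s≤s (s≤s (s≤s z≤n)))
  ... | o , k , o<3 , i+o≡ | o′ , k′ , o′<3 , i+o′≡ = pos≢neg (begin
    pos              ≡⟨ w-3k+0 k ⟨
    w (k * 3 + 0)    ≡⟨ cong w i+o≡ ⟨
    w (i + o)        ≡⟨ constant o<3 ⟩
    w i              ≡⟨ constant o′<3 ⟨
    w (i + o′)       ≡⟨ cong w i+o′≡ ⟩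
    w (k′ * 3 + 2)   ≡⟨ w-3k+2 k′ ⟩
    neg              ∎)
    where
    constant : ∀ {o} → o < 3 → w (i + o) ≡ w i
    constant {0} _ = cong w (+-identityʳ i)
    constant {1} _ = sym (repeats-at cube (s≤s z≤n) (+-identityʳ i))
    constant {2} _ = begin
      w (i + 2)      ≡⟨ cong w (+-assoc i 1 1) ⟨
      w (i + 1 + 1)  ≡⟨ repeats-at cube (s≤s (s≤s z≤n)) refl ⟨
      w (i + 1)      ≡⟨ constant {1} (s≤s (s≤s z≤n)) ⟩
      w i            ∎
    constant {suc (suc (suc _))} (s≤s (s≤s (s≤s ())))

  ¬cube-3k+1 : ∀ q {i} → 0 < q → ¬ CubeAt w (q * 3 + 1) i
  ¬cube-3k+1 (suc q) {i} _ cube with shift-to-residue i {2} (s≤s (s≤s (s≤s z≤n)))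
  ... | o , k , o<3 , i+o≡ = pos≢neg (begin
    pos                               ≡⟨ w-3k+0 (k + suc q + 1) ⟨
    w ((k + suc q + 1) * 3 + 0)       ≡⟨ cong w (regroup k q) ⟨
    w (k * 3 + 2 + (suc q * 3 + 1))   ≡⟨ repeats-at cube (<3⇒<p+p (suc q * 3 + 1) (s≤s (s≤s z≤n)) o<3) i+o≡ ⟨
    w (k * 3 + 2)                     ≡⟨ w-3k+2 k ⟩
    neg                               ∎)
    where
    regroup : ∀ k q → k * 3 + 2 + (suc q * 3 + 1) ≡ (k + suc q + 1) * 3 + 0
    regroup = solve-∀

  ¬cube-3k+2 : ∀ q {i} → ¬ CubeAt w (q * 3 + 2) i
  ¬cube-3k+2 q {i} cube with shift-to-residue i {0} (s≤s z≤n)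
  ... | o , k , o<3 , i+o≡ = pos≢neg (begin
    pos                           ≡⟨ w-3k+0 k ⟨
    w (k * 3 + 0)                 ≡⟨ repeats-at cube (<3⇒<p+p (q * 3 + 2) (m≤n+m 2 (q * 3)) o<3) i+o≡ ⟩
    w (k * 3 + 0 + (q * 3 + 2))   ≡⟨ cong w (regroup k q) ⟩
    w ((k + q) * 3 + 2)           ≡⟨ w-3k+2 (k + q) ⟩
    neg                           ∎)
    where
    regroup : ∀ k q → k * 3 + 0 + (q * 3 + 2) ≡ (k + q) * 3 + 2
    regroup = solve-∀

  cube-3k⇒cube : ∀ q {i} → CubeAt w (q * 3 + 0) i → ∃ (CubeAt w q)
  cube-3k⇒cube q {i} cube with shift-to-residue i {1} (s≤s (s≤s z≤n))
  ... | o , i′ , o<3 , i+o≡ = i′ , cubeAt λ j j<2q → begin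
    w (i′ + j)                             ≡⟨ w-3k+1 (i′ + j) ⟨
    w ((i′ + j) * 3 + 1)                   ≡⟨ repeats-at cube (j*3+o<6q j<2q o<3) (lands j o i+o≡) ⟩
    w ((i′ + j) * 3 + 1 + (q * 3 + 0))     ≡⟨ cong w (regroup i′ j q) ⟩
    w ((i′ + j + q) * 3 + 1)               ≡⟨ w-3k+1 (i′ + j + q) ⟩
    w (i′ + j + q)                         ∎
    where
    regroup : ∀ i′ j q → (i′ + j) * 3 + 1 + (q * 3 + 0) ≡ (i′ + j + q) * 3 + 1
    regroup = solve-∀
    double : ∀ q → (q + q) * 3 ≡ q * 3 + 0 + (q * 3 + 0)
    double = solve-∀
    j*3+o<6q : ∀ {j o} → j < q + q → o < 3 → j * 3 + o < q * 3 + 0 + (q * 3 + 0)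
    j*3+o<6q {j} {o} j<2q o<3 = subst (j * 3 + o <_) (double q) (k*3+r<n*3 j<2q o<3)
    lands : ∀ j o → i + o ≡ i′ * 3 + 1 → i + (j * 3 + o) ≡ (i′ + j) * 3 + 1
    lands j o i+o≡ = begin
      i + (j * 3 + o)      ≡⟨ rearrange i j o ⟩
      j * 3 + (i + o)      ≡⟨ cong (j * 3 +_) i+o≡ ⟩
      j * 3 + (i′ * 3 + 1) ≡⟨ collect i′ j ⟩
      (i′ + j) * 3 + 1     ∎
      where
      rearrange : ∀ i j o → i + (j * 3 + o) ≡ j * 3 + (i + o)
      rearrange = solve-∀
      collect : ∀ i′ j → j * 3 + (i′ * 3 + 1) ≡ (i′ + j) * 3 + 1
      collect = solve-∀

  ¬cube : ∀ p → 0 < p → ∀ i → ¬ CubeAt w p i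
  ¬cube = <-rec (λ p → 0 < p → ∀ i → ¬ CubeAt w p i) step
    where
    step : ∀ p → (∀ {q} → q < p → 0 < q → ∀ i → ¬ CubeAt w q i) → 0 < p → ∀ i → ¬ CubeAt w p i
    step p rec 0<p i cube with mod3 p
    step _ rec () i cube | 3k+0 zero
    step _ rec 0<p i cube | 3k+0 (suc q) with cube-3k⇒cube (suc q) cube
    ... | i′ , cube′ = rec q<3q (s≤s z≤n) i′ cube′
      where
      q<3q : suc q < suc q * 3 + 0
      q<3q = subst (suc q <_) (sym (+-identityʳ _)) (m<m*n (suc q) 3 (s≤s (s≤s z≤n)))
    step _ rec 0<p i cube | 3k+1 zero    = ¬cube-1 cube
    step _ rec 0<p i cube | 3k+1 (suc q) = ¬cube-3k+1 (suc q) (s≤s z≤n) cube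
    step _ rec 0<p i cube | 3k+2 q       = ¬cube-3k+2 q cube

  cubeFree : CubeFree w
  cubeFree u 0<|u| i occ = ¬cube (length u) 0<|u| i (occurs-cube⇒cubeAt u occ)

mainTheorem2 : CubeFree wα
mainTheorem2 = FixedPoint.cubeFree wα wα-isFixedPoint
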